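{- For $n=2$, there is a polytope with a pair of vertices $v^{(1)},v^{(2)}$ for which every optimal feasible circuit walk between them is not maximal, and there is such an optimal feasible walk that is non-repetitive and non-backwards. Hence for this pair, $\mathcal{CD}_{fm}\neq\mathcal{CD}_{f}$, $\mathcal{CD}_{fmb}\neq\mathcal{CD}_{fb}$ and $\mathcal{CD}_{fmr}\neq\mathcal{CD}_{fr}$.
   Context: Polytopes are $P=\{z\in\mathbb{R}^n: Az=b,\ Bz\leq d\}$ with integer matrices $A,B$ (here $n=2$). A circuit is a vector $g\in\ker(A)\setminus\{0\}$ such that $Bg$ has inclusion-minimal support in $\{Bz: z\in\ker(A)\setminus\{0\}\}$, normalized to coprime integer components. A circuit walk of length $k$ from vertex $v^{(1)}$ to vertex $v^{(2)}$ is $v^{(1)}=y^{(0)},\dots,y^{(k)}=v^{(2)}$ with $y^{(i+1)}-y^{(i)}=\alpha_ig^i$, $g^i$ circuits, $\alpha_i>0$. Properties: (f) feasible: all $y^{(i)}\in P$; (m) maximal: $y^{(i)}+\alpha g^i\notin P$ for all $\alpha>\alpha_i$; (r) non-repetitive: $g^i\neq g^j$ for $i\neq j$; (b) non-backwards: $g^j\neq-g^i$ for all $i,j$. $\mathcal{CD}_X(v^{(1)},v^{(2)})$ is the minimum length of a circuit walk with all properties in $X$; a walk attaining it is optimal.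
   Formalization: Points, the right-hand sides b and d, and the step lengths $\alpha_i$ are rational rather than real, so optimality, maximality, vertices, circuits and the circuit-distance minima quantify only over rational walks and vectors. -}

module Defs where

open import Data.Nat as ℕ using (ℕ)
open import Data.Nat.GCD using (gcd)
open import Data.Fin using (Fin; zero; suc)
open import Data.Integer as ℤ using (ℤ)
open import Data.Rational as ℚ using (ℚ; 0ℚ; _+_; _*_; _≤_; _<_; -_; _/_)
open import Data.List using (List; []; _∷_; map; length)
open import Data.List.Relation.Unary.All using (All)
open import Data.List.Relation.Unary.AllPairs using (AllPairs)
open import Data.Product using (Σ; ∃; _×_; _,_)
open import Data.Unit using (⊤)
open import Relation.Binary.PropositionalEquality using (_≡_; _≢_)
open import Relation.Nullary using (¬_)

-- Points of ℝ² are modelled by ℚ².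
Pt : Set
Pt = Fin 2 → ℚ

IntVec : Set
IntVec = Fin 2 → ℤ

ι : ℤ → ℚ
ι z = z / 1

ιv : IntVec → Pt
ιv g k = ι (g k)

_⊕_ : Pt → Pt → Pt
(x ⊕ y) k = x k + y k

_·_ : ℚ → Pt → Pt
(a · x) k = a * x k

neg : Pt → Pt
neg x k = - x k

_≈_ : Pt → Pt → Set
x ≈ y = ∀ k → x k ≡ y k

IsZero : Pt → Set
IsZero x = ∀ k → x k ≡ 0ℚ

row : (Fin 2 → ℤ) → Pt → ℚ
row a z = ι (a zero) * z zero + ι (a (suc zero)) * z (suc zero)

record Polytope : Set where
  field
    m₁ m₂ : ℕ
    A : Fin m₁ → Fin 2 → ℤ
    b : Fin m₁ → ℚ
    B : Fin m₂ → Fin 2 → ℤ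
    d : Fin m₂ → ℚ

record Step : Set where
  constructor step
  field
    α : ℚ
    g : IntVec

open Step public

module _ (P : Polytope) where
  open Polytope P

  InP : Pt → Set
  InP z = (∀ i → row (A i) z ≡ b i) × (∀ j → row (B j) z ≤ d j)

  Bounded : Set
  Bounded = ∃ λ (M : ℚ) → ∀ z → InP z → ∀ k → (- M ≤ z k) × (z k ≤ M)

  IsVertex : Pt → Set
  IsVertex v = InP v × (∀ g → InP (v ⊕ g) → InP (v ⊕ neg g) → IsZero g)

  InKer : Pt → Set
  InKer z = ∀ i → row (A i) z ≡ 0ℚ

  InSupp : Pt → Fin m₂ → Set
  InSupp z j = row (B j) z ≢ 0ℚ

  IsCircuit : IntVec → Set
  IsCircuit g =
    InKer (ιv g) × ¬ IsZero (ιv g) ×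
    (∀ z → InKer z → ¬ IsZero z →
       (∀ j → InSupp z j → InSupp (ιv g) j) →
       (∀ j → InSupp (ιv g) j → InSupp z j)) ×
    gcd (ℤ.∣ g zero ∣) (ℤ.∣ g (suc zero) ∣) ≡ 1

  next : Pt → Step → Pt
  next y s = y ⊕ (α s · ιv (g s))

  endpoint : Pt → List Step → Pt
  endpoint y [] = y
  endpoint y (s ∷ w) = endpoint (next y s) w

  CircuitWalk : Pt → Pt → List Step → Set
  CircuitWalk v₁ v₂ w =
    All (λ s → (0ℚ < α s) × IsCircuit (g s)) w × endpoint v₁ w ≈ v₂

  Feasible : Pt → List Step → Set
  Feasible y [] = InP y
  Feasible y (s ∷ w) = InP y × Feasible (next y s) w

  Maximal : Pt → List Step → Set
  Maximal y [] = ⊤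
  Maximal y (s ∷ w) =
    (∀ β → α s < β → ¬ InP (y ⊕ (β · ιv (g s)))) × Maximal (next y s) w

  NonRepetitive : List Step → Set
  NonRepetitive w = AllPairs (λ g₁ g₂ → ¬ (∀ k → g₁ k ≡ g₂ k)) (map g w)

  NonBackwards : List Step → Set
  NonBackwards w =
    All (λ g₁ → All (λ g₂ → ¬ (∀ k → g₂ k ≡ ℤ.- g₁ k)) (map g w)) (map g w)

data Property : Set where
  f m r b : Property

module _ (P : Polytope) where

  Holds : Property → Pt → List Step → Set
  Holds f y w = Feasible P y w
  Holds m y w = Maximal P y w
  Holds r y w = NonRepetitive P w
  Holds b y w = NonBackwards P w

  HasAll : List Property → Pt → List Step → Set
  HasAll X y w = All (λ p → Holds p y w) X

  IsCD : List Property → Pt → Pt → ℕ → Set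
  IsCD X v₁ v₂ k =
    (∃ λ w → CircuitWalk P v₁ v₂ w × HasAll X v₁ w × length w ≡ k) ×
    (∀ w → CircuitWalk P v₁ v₂ w → HasAll X v₁ w → k ℕ.≤ length w)

  OptimalFeasible : Pt → Pt → List Step → Set
  OptimalFeasible v₁ v₂ w =
    CircuitWalk P v₁ v₂ w × Feasible P v₁ w ×
    (∀ w′ → CircuitWalk P v₁ v₂ w′ → Feasible P v₁ w′ → length w ℕ.≤ length w′)

-- Take the hexagon 0 ≤ x, y ≤ 3, x − 2y ≤ 1, −2x + y ≤ 1 with v₁ = (3,3), v₂ = (0,0).  In the
-- plane a circuit is orthogonal to some row of B (the vector (2,1) ⊥ (1,−2) rules out full
-- support), so every circuit step keeps one of the four forms x − 2y, x, y, −2x + y constant.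
-- Each form separates v₁ from v₂, hence every circuit walk has at least two steps, and
-- (3,3) → (1,2) → (0,0) is an optimal feasible walk.  In a two-step walk the turning point is
-- the intersection of a level line through v₁ with one through v₂; each of the twelve candidates
-- is either infeasible or lets the first step be prolonged by the factor 4/3.  So no optimal
-- feasible walk is maximal, while the maximal walk (3,3) → (3,1) → (1,0) → (0,0) has length 3.

module Submission where

open import Defs
open import Data.Nat using (ℕ)
open import Data.List using (List; []; _∷_; length; map; take)
open import Data.Product using (Σ; ∃; _×_; _,_)
open import Relation.Binary.PropositionalEquality using (_≢_)
open import Relation.Nullary using (¬_)

import Data.Nat as ℕ
import Data.Nat.Properties as ℕ
open import Data.Nat.GCD using (gcd)
open import Data.Fin as Fin using (Fin; zero; suc; _↑ˡ_; #_)
open import Data.Fin.Properties using (all?; ¬∀⟶∃¬)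
open import Data.Integer as ℤ using (ℤ; -1ℤ)
open import Data.Rational as ℚ using (ℚ; 0ℚ; 1ℚ; _+_; _*_; _-_; -_; _≤_; _<_; _/_; 1/_)
import Data.Rational.Properties as ℚ
open import Data.Rational.Solver using (module +-*-Solver)
open import Data.Vec as Vec using (Vec; []; _∷_)
open import Data.List.Relation.Unary.All as All using (All; []; _∷_)
import Data.List.Relation.Unary.AllPairs as AllPairs
open import Data.Sum using (_⊎_; inj₁; inj₂)
open import Data.Unit using (tt)
open import Data.Empty using (⊥-elim)
open import Relation.Binary.PropositionalEquality
  using (_≡_; refl; sym; trans; cong; cong₂; subst; subst₂; module ≡-Reasoning)
open import Relation.Nullary using (Dec; yes; no; ¬?)
open import Relation.Nullary.Decidable
  using (True; toWitness; from-yes; decidable-stable; _×-dec_; _⊎-dec_; _→-dec_)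

open +-*-Solver

⟨_,_⟩ : {A : Set} → A → A → Fin 2 → A
⟨ x , y ⟩ zero = x
⟨ x , y ⟩ (suc _) = y

*-cancelˡ-≡ : ∀ p {x y} → p ≢ 0ℚ → p * x ≡ p * y → x ≡ y
*-cancelˡ-≡ p {x} {y} p≢0 eq = begin
  x                ≡⟨ ℚ.*-identityˡ x ⟨
  1ℚ * x           ≡⟨ cong (_* x) (ℚ.*-inverseˡ p) ⟨
  (1/ p * p) * x   ≡⟨ ℚ.*-assoc (1/ p) p x ⟩
  1/ p * (p * x)   ≡⟨ cong (1/ p *_) eq ⟩
  1/ p * (p * y)   ≡⟨ ℚ.*-assoc (1/ p) p y ⟨
  (1/ p * p) * y   ≡⟨ cong (_* y) (ℚ.*-inverseˡ p) ⟩
  1ℚ * y           ≡⟨ ℚ.*-identityˡ y ⟩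
  y                ∎
  where
  open ≡-Reasoning
  instance
    p-nonZero : ℚ.NonZero p
    p-nonZero = ℚ.≢-nonZero p≢0

row-cong : ∀ a {x y} → x ≈ y → row a x ≡ row a y
row-cong a x≈y =
  cong₂ (λ x₀ x₁ → ι (a zero) * x₀ + ι (a (suc zero)) * x₁) (x≈y zero) (x≈y (suc zero))

row-⊕ : ∀ a x y → row a (x ⊕ y) ≡ row a x + row a y
row-⊕ a x y = solve 6 (λ a₀ a₁ x₀ x₁ y₀ y₁ →
  a₀ :* (x₀ :+ y₀) :+ a₁ :* (x₁ :+ y₁) := (a₀ :* x₀ :+ a₁ :* x₁) :+ (a₀ :* y₀ :+ a₁ :* y₁)) refl
  (ι (a zero)) (ι (a (suc zero))) (x zero) (x (suc zero)) (y zero) (y (suc zero))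

row-· : ∀ a s x → row a (s · x) ≡ s * row a x
row-· a s x = solve 5 (λ a₀ a₁ s x₀ x₁ →
  a₀ :* (s :* x₀) :+ a₁ :* (s :* x₁) := s :* (a₀ :* x₀ :+ a₁ :* x₁)) refl
  (ι (a zero)) (ι (a (suc zero))) s (x zero) (x (suc zero))

row-neg : ∀ a x → row a (neg x) ≡ - row a x
row-neg a x = solve 4 (λ a₀ a₁ x₀ x₁ →
  a₀ :* (:- x₀) :+ a₁ :* (:- x₁) := :- (a₀ :* x₀ :+ a₁ :* x₁)) refl
  (ι (a zero)) (ι (a (suc zero))) (x zero) (x (suc zero))

row-step : ∀ a y α g → row a (y ⊕ (α · g)) ≡ row a y + α * row a g
row-step a y α g = trans (row-⊕ a y (α · g)) (cong (row a y +_) (row-· a α g))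

row-step-⊥ : ∀ a y α g → row a g ≡ 0ℚ → row a (y ⊕ (α · g)) ≡ row a y
row-step-⊥ a y α g ag≡0 = begin
  row a (y ⊕ (α · g))  ≡⟨ row-step a y α g ⟩
  row a y + α * row a g ≡⟨ cong (λ t → row a y + α * t) ag≡0 ⟩
  row a y + α * 0ℚ      ≡⟨ solve 2 (λ r α → r :+ α :* con 0ℚ := r) refl (row a y) α ⟩
  row a y               ∎
  where open ≡-Reasoning

det : IntVec → IntVec → ℚ
det a c = ι (a zero) * ι (c (suc zero)) - ι (a (suc zero)) * ι (c zero)

cramer₀ : ∀ a c x → det a c * x zero ≡ row a x * ι (c (suc zero)) - row c x * ι (a (suc zero))
cramer₀ a c x = solve 6 (λ a₀ a₁ c₀ c₁ x₀ x₁ →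
  (a₀ :* c₁ :- a₁ :* c₀) :* x₀ := (a₀ :* x₀ :+ a₁ :* x₁) :* c₁ :- (c₀ :* x₀ :+ c₁ :* x₁) :* a₁) refl
  (ι (a zero)) (ι (a (suc zero))) (ι (c zero)) (ι (c (suc zero))) (x zero) (x (suc zero))

cramer₁ : ∀ a c x → det a c * x (suc zero) ≡ ι (a zero) * row c x - ι (c zero) * row a x
cramer₁ a c x = solve 6 (λ a₀ a₁ c₀ c₁ x₀ x₁ →
  (a₀ :* c₁ :- a₁ :* c₀) :* x₁ := a₀ :* (c₀ :* x₀ :+ c₁ :* x₁) :- c₀ :* (a₀ :* x₀ :+ a₁ :* x₁)) refl
  (ι (a zero)) (ι (a (suc zero))) (ι (c zero)) (ι (c (suc zero))) (x zero) (x (suc zero))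

rows-determine : ∀ a c {x y} → det a c ≢ 0ℚ → row a x ≡ row a y → row c x ≡ row c y → x ≈ y
rows-determine a c {x} {y} det≢0 ax≡ay cx≡cy zero = *-cancelˡ-≡ (det a c) det≢0 (begin
  det a c * x zero
    ≡⟨ cramer₀ a c x ⟩
  row a x * ι (c (suc zero)) - row c x * ι (a (suc zero))
    ≡⟨ cong₂ (λ s t → s * ι (c (suc zero)) - t * ι (a (suc zero))) ax≡ay cx≡cy ⟩
  row a y * ι (c (suc zero)) - row c y * ι (a (suc zero))
    ≡⟨ cramer₀ a c y ⟨
  det a c * y zero ∎)
  where open ≡-Reasoning
rows-determine a c {x} {y} det≢0 ax≡ay cx≡cy (suc zero) = *-cancelˡ-≡ (det a c) det≢0 (begin
  det a c * x (suc zero)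
    ≡⟨ cramer₁ a c x ⟩
  ι (a zero) * row c x - ι (c zero) * row a x
    ≡⟨ cong₂ (λ s t → ι (a zero) * t - ι (c zero) * s) ax≡ay cx≡cy ⟩
  ι (a zero) * row c y - ι (c zero) * row a y
    ≡⟨ cramer₁ a c y ⟨
  det a c * y (suc zero) ∎)
  where open ≡-Reasoning

parallel-row≡0 : ∀ a c {x} → det a c ≡ 0ℚ → ¬ IsZero (ιv a) → row a x ≡ 0ℚ → row c x ≡ 0ℚ
parallel-row≡0 a c {x} det≡0 a≢0 ax≡0 = decidable-stable (row c x ℚ.≟ 0ℚ) λ cx≢0 →
  a≢0 λ k → *-cancelˡ-≡ (row c x) cx≢0 (trans (cx*a≡0 k) (sym (ℚ.*-zeroʳ (row c x))))
  where
  open ≡-Reasoning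
  cx*a≡0 : ∀ k → row c x * ι (a k) ≡ 0ℚ
  cx*a≡0 zero = begin
    row c x * ι (a zero)
      ≡⟨ solve 4 (λ r s a₀ c₀ → r :* a₀ := (a₀ :* r :- c₀ :* s) :+ c₀ :* s) refl
           (row c x) (row a x) (ι (a zero)) (ι (c zero)) ⟩
    (ι (a zero) * row c x - ι (c zero) * row a x) + ι (c zero) * row a x
      ≡⟨ cong₂ (λ s t → s + ι (c zero) * t) (sym (cramer₁ a c x)) ax≡0 ⟩
    det a c * x (suc zero) + ι (c zero) * 0ℚ
      ≡⟨ cong (λ d → d * x (suc zero) + ι (c zero) * 0ℚ) det≡0 ⟩
    0ℚ * x (suc zero) + ι (c zero) * 0ℚ
      ≡⟨ solve 2 (λ x₁ c₀ → con 0ℚ :* x₁ :+ c₀ :* con 0ℚ := con 0ℚ) refl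
           (x (suc zero)) (ι (c zero)) ⟩
    0ℚ ∎
  cx*a≡0 (suc zero) = begin
    row c x * ι (a (suc zero))
      ≡⟨ solve 4 (λ r s a₁ c₁ → r :* a₁ := s :* c₁ :- (s :* c₁ :- r :* a₁)) refl
           (row c x) (row a x) (ι (a (suc zero))) (ι (c (suc zero))) ⟩
    row a x * ι (c (suc zero)) - (row a x * ι (c (suc zero)) - row c x * ι (a (suc zero)))
      ≡⟨ cong₂ (λ s t → s * ι (c (suc zero)) - t) ax≡0 (sym (cramer₀ a c x)) ⟩
    0ℚ * ι (c (suc zero)) - det a c * x zero
      ≡⟨ cong (λ d → 0ℚ * ι (c (suc zero)) - d * x zero) det≡0 ⟩
    0ℚ * ι (c (suc zero)) - 0ℚ * x zero
      ≡⟨ solve 2 (λ c₁ x₀ → con 0ℚ :* c₁ :- con 0ℚ :* x₀ := con 0ℚ) refl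
           (ι (c (suc zero))) (x zero) ⟩
    0ℚ ∎

0ᵛ : Pt
0ᵛ _ = 0ℚ

row-0ᵛ : ∀ a → row a 0ᵛ ≡ 0ℚ
row-0ᵛ a =
  solve 2 (λ a₀ a₁ → a₀ :* con 0ℚ :+ a₁ :* con 0ℚ := con 0ℚ) refl (ι (a zero)) (ι (a (suc zero)))

orthogonal-line-row≡0 : ∀ a c {x y} → ¬ IsZero (ιv a) → row a x ≡ 0ℚ → row a y ≡ 0ℚ →
  ¬ IsZero y → row c y ≡ 0ℚ → row c x ≡ 0ℚ
orthogonal-line-row≡0 a c {x} a≢0 ax≡0 ay≡0 y≢0 cy≡0 with det a c ℚ.≟ 0ℚ
... | yes det≡0 = parallel-row≡0 a c {x} det≡0 a≢0 ax≡0
... | no det≢0  = ⊥-elim (y≢0 (rows-determine a c det≢0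
                    (trans ay≡0 (sym (row-0ᵛ a))) (trans cy≡0 (sym (row-0ᵛ c)))))

p+q≤p⇒q≤0 : ∀ {p q} → p + q ≤ p → q ≤ 0ℚ
p+q≤p⇒q≤0 {p} {q} p+q≤p = subst₂ _≤_
  (solve 2 (λ p q → (p :+ q) :+ (:- p) := q) refl p q) (ℚ.+-inverseʳ p) (ℚ.+-monoˡ-≤ (- p) p+q≤p)

-p≤0⇒0≤p : ∀ {p} → - p ≤ 0ℚ → 0ℚ ≤ p
-p≤0⇒0≤p {p} -p≤0 = subst (0ℚ ≤_) (solve 1 (λ p → :- (:- p) := p) refl p) (ℚ.neg-antimono-≤ -p≤0)

p+q≤p∧p-q≤p⇒q≡0 : ∀ {p q} → p + q ≤ p → p + - q ≤ p → q ≡ 0ℚ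
p+q≤p∧p-q≤p⇒q≡0 p+q≤p p-q≤p =
  ℚ.≤-antisym (p+q≤p⇒q≤0 p+q≤p) (-p≤0⇒0≤p (p+q≤p⇒q≤0 p-q≤p))

module _ (P : Polytope) where
  open Polytope P hiding (b)

  InP-resp-≈ : ∀ {x y} → x ≈ y → InP P x → InP P y
  InP-resp-≈ x≈y (eqs , ineqs) =
    (λ i → trans (sym (row-cong (A i) x≈y)) (eqs i)) ,
    (λ j → subst (_≤ d j) (row-cong (B j) x≈y) (ineqs j))

  InP? : ∀ x → Dec (InP P x)
  InP? x = all? (λ i → row (A i) x ℚ.≟ Polytope.b P i) ×-dec all? (λ j → row (B j) x ℚ.≤? d j)

  Feasible? : ∀ y w → Dec (Feasible P y w)
  Feasible? y []      = InP? y
  Feasible? y (s ∷ w) = InP? y ×-dec Feasible? (next P y s) w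

  ≈ᶻ? : (g h : IntVec) → Dec (∀ k → g k ≡ h k)
  ≈ᶻ? g h = all? λ k → g k ℤ.≟ h k

  NonRepetitive? : ∀ w → Dec (NonRepetitive P w)
  NonRepetitive? w = AllPairs.allPairs? (λ g h → ¬? (≈ᶻ? g h)) (map Step.g w)

  NonBackwards? : ∀ w → Dec (NonBackwards P w)
  NonBackwards? w = All.all? (λ g → All.all? (λ h → ¬? (≈ᶻ? h (λ k → ℤ.- g k))) gs) gs
    where gs = map Step.g w

  PrimitiveOrthogonal : IntVec → Fin m₂ → Set
  PrimitiveOrthogonal g j =
    InKer P (ιv g) × ¬ IsZero (ιv g) × gcd (ℤ.∣ g zero ∣) (ℤ.∣ g (suc zero) ∣) ≡ 1 ×
    ¬ IsZero (ιv (B j)) × row (B j) (ιv g) ≡ 0ℚ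

  primitiveOrthogonal? : ∀ g j → Dec (PrimitiveOrthogonal g j)
  primitiveOrthogonal? g j =
          all? (λ i → row (A i) (ιv g) ℚ.≟ 0ℚ)
    ×-dec ¬? (all? λ k → ιv g k ℚ.≟ 0ℚ)
    ×-dec gcd (ℤ.∣ g zero ∣) (ℤ.∣ g (suc zero) ∣) ℕ.≟ 1
    ×-dec ¬? (all? λ k → ιv (B j) k ℚ.≟ 0ℚ)
    ×-dec row (B j) (ιv g) ℚ.≟ 0ℚ

  primitiveOrthogonal⇒circuit : ∀ g j → PrimitiveOrthogonal g j → IsCircuit P g
  primitiveOrthogonal⇒circuit g j (g∈ker , g≢0 , coprime , Bj≢0 , Bjg≡0) =
    g∈ker , g≢0 , minimal , coprime
    where
    minimal : ∀ z → InKer P z → ¬ IsZero z → (∀ j′ → InSupp P z j′ → InSupp P (ιv g) j′) →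
      ∀ j′ → InSupp P (ιv g) j′ → InSupp P z j′
    minimal z _ z≢0 z⊆g j′ j′∈g Bj′z≡0 =
      j′∈g (orthogonal-line-row≡0 (B j) (B j′) {ιv g} {z} Bj≢0 Bjg≡0 Bjz≡0 z≢0 Bj′z≡0)
      where
      Bjz≡0 : row (B j) z ≡ 0ℚ
      Bjz≡0 = decidable-stable (row (B j) z ℚ.≟ 0ℚ) (λ Bjz≢0 → z⊆g j Bjz≢0 Bjg≡0)

  circuit-step : ∀ α g j → {True (0ℚ ℚ.<? α)} → {True (primitiveOrthogonal? g j)} →
    0ℚ < α × IsCircuit P g
  circuit-step α g j {0<α} {g⊥Bj} = toWitness 0<α , primitiveOrthogonal⇒circuit g j (toWitness g⊥Bj)

  circuit-has-zero-row : ∀ {g z} j → IsCircuit P g → InKer P z → ¬ IsZero z → row (B j) z ≡ 0ℚ →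
    ∃ λ j′ → row (B j′) (ιv g) ≡ 0ℚ
  circuit-has-zero-row {g} {z} j (_ , _ , minimal , _) z∈ker z≢0 Bjz≡0
    with ¬∀⟶∃¬ m₂ (InSupp P (ιv g)) (λ j′ → ¬? (row (B j′) (ιv g) ℚ.≟ 0ℚ))
           (λ full → minimal z z∈ker z≢0 (λ j′ _ → full j′) j (full j) Bjz≡0)
  ... | j′ , j′∉g = j′ , decidable-stable (row (B j′) (ιv g) ℚ.≟ 0ℚ) j′∉g

  tight-rows⇒vertex : ∀ v j j′ → InP P v → row (B j) v ≡ d j → row (B j′) v ≡ d j′ →
    det (B j) (B j′) ≢ 0ℚ → IsVertex P v
  tight-rows⇒vertex v j j′ v∈P tight tight′ det≢0 = v∈P , λ g (_ , v+g) (_ , v-g) →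
    rows-determine (B j) (B j′) {g} {0ᵛ} det≢0
      (trans (orthogonal {g} j tight (v+g j) (v-g j)) (sym (row-0ᵛ (B j))))
      (trans (orthogonal {g} j′ tight′ (v+g j′) (v-g j′)) (sym (row-0ᵛ (B j′))))
    where
    orthogonal : ∀ {g} i → row (B i) v ≡ d i →
      row (B i) (v ⊕ g) ≤ d i → row (B i) (v ⊕ neg g) ≤ d i → row (B i) g ≡ 0ℚ
    orthogonal {g} i tight v+g≤ v-g≤ = p+q≤p∧p-q≤p⇒q≡0
      (subst₂ _≤_ (row-⊕ (B i) v g) (sym tight) v+g≤)
      (subst₂ _≤_ (trans (row-⊕ (B i) v (neg g)) (cong (row (B i) v +_) (row-neg (B i) g)))
                  (sym tight) v-g≤)

  tight-step-maximal : ∀ y α g j → 0ℚ < row (B j) (ιv g) → row (B j) (next P y (step α g)) ≡ d j →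
    ∀ β → α < β → ¬ InP P (y ⊕ (β · ιv g))
  tight-step-maximal y α g j Bjg>0 tight β α<β (_ , ineqs) =
    ℚ.<-irrefl refl (ℚ.<-≤-trans (begin-strict
      d j                                ≡⟨ tight ⟨
      row (B j) (y ⊕ (α · ιv g))         ≡⟨ row-step (B j) y α (ιv g) ⟩
      row (B j) y + α * row (B j) (ιv g) <⟨ ℚ.+-monoʳ-< (row (B j) y) αBjg<βBjg ⟩
      row (B j) y + β * row (B j) (ιv g) ≡⟨ row-step (B j) y β (ιv g) ⟨
      row (B j) (y ⊕ (β · ιv g))         ∎) (ineqs j))
    where
    open ℚ.≤-Reasoning
    αBjg<βBjg : α * row (B j) (ιv g) < β * row (B j) (ιv g)
    αBjg<βBjg = ℚ.*-monoˡ-<-pos (row (B j) (ιv g)) {{ℚ.positive Bjg>0}} α<β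

ray : Pt → Pt → ℚ → Pt
ray v p λ′ = v ⊕ (λ′ · (p ⊕ neg v))

ray-step : ∀ v α λ′ x {p} → (v ⊕ (α · x)) ≈ p → ray v p λ′ ≈ (v ⊕ ((α * λ′) · x))
ray-step v α λ′ x v+αx≈p k = trans
  (cong (λ t → v k + λ′ * (t + - v k)) (sym (v+αx≈p k)))
  (solve 4 (λ v α λ′ x → v :+ λ′ :* ((v :+ α :* x) :+ :- v) := v :+ (α :* λ′) :* x) refl
     (v k) α λ′ (x k))

p<p*q : ∀ {p q} → 0ℚ < p → 1ℚ < q → p < p * q
p<p*q {p} 0<p 1<q = subst (_< p * _) (ℚ.*-identityʳ p) (ℚ.*-monoʳ-<-pos p {{ℚ.positive 0<p}} 1<q)

nonzero-at : ∀ {x : Pt} k → x k ≢ 0ℚ → ¬ IsZero x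
nonzero-at k xk≢0 x≡0 = xk≢0 (x≡0 k)

-- Literal overloading is confined to this module: it breaks elaboration of the ℕ argument of
-- the ring solver's solve.
module Hexagon where
  open import Agda.Builtin.FromNat using (Number; fromNat)
  open import Agda.Builtin.FromNeg using (Negative; fromNeg)
  open import Data.Unit using (⊤)
  import Data.Nat.Literals as ℕLiterals
  import Data.Integer.Literals as ℤLiterals
  import Data.Rational.Literals as ℚLiterals

  instance
    ℕ-number : Number ℕ
    ℕ-number = ℕLiterals.number
    ℤ-number : Number ℤ
    ℤ-number = ℤLiterals.number
    ℤ-negative : Negative ℤ
    ℤ-negative = ℤLiterals.negative
    ℚ-number : Number ℚ
    ℚ-number = ℚLiterals.number
    ℚ-negative : Negative ℚ
    ℚ-negative = ℚLiterals.negative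
    literal-constraint : ⊤
    literal-constraint = tt

  -- The hexagon with vertices (0,0), (1,0), (3,1), (3,3), (1,3), (0,1).
  hexagon : Polytope
  hexagon = record
    { m₁ = 0 ; m₂ = 6 ; A = λ () ; b = λ ()
    ; B = Vec.lookup (⟨ 1 , -2 ⟩ ∷ ⟨ 1 , 0 ⟩ ∷ ⟨ 0 , 1 ⟩ ∷ ⟨ -2 , 1 ⟩ ∷ ⟨ -1 , 0 ⟩ ∷ ⟨ 0 , -1 ⟩ ∷ [])
    ; d = Vec.lookup (1 ∷ 3 ∷ 3 ∷ 1 ∷ 0 ∷ 0 ∷ [])
    }

  v₁ v₂ : Pt
  v₁ = ⟨ 3 , 3 ⟩
  v₂ = ⟨ 0 , 0 ⟩

  w₂ w₃ : List Step
  w₂ = step 1 ⟨ -2 , -1 ⟩ ∷ step 1 ⟨ -1 , -2 ⟩ ∷ []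
  w₃ = step 2 ⟨ 0 , -1 ⟩ ∷ step 1 ⟨ -2 , -1 ⟩ ∷ step 1 ⟨ -1 , 0 ⟩ ∷ []

  -- Entry (c, c′) is the intersection of the line through v₁ orthogonal to row c of B with
  -- the line through v₂ orthogonal to row c′.
  meet : Fin 4 → Fin 4 → Pt
  meet c c′ = Vec.lookup (Vec.lookup table c) c′
    where
    table : Vec (Vec Pt 4) 4
    table = (v₁            ∷ ⟨ 0 , 3 / 2 ⟩ ∷ ⟨ -3 , 0 ⟩    ∷ ⟨ 1 , 2 ⟩     ∷ [])
      ∷ (⟨ 3 , 3 / 2 ⟩ ∷ v₁            ∷ ⟨ 3 , 0 ⟩     ∷ ⟨ 3 , 6 ⟩     ∷ [])
      ∷ (⟨ 6 , 3 ⟩     ∷ ⟨ 0 , 3 ⟩     ∷ v₁            ∷ ⟨ 3 / 2 , 3 ⟩ ∷ [])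
      ∷ (⟨ 2 , 1 ⟩     ∷ ⟨ 0 , -3 ⟩    ∷ ⟨ 3 / 2 , 0 ⟩ ∷ v₁            ∷ [])
      ∷ []

  w₂-walk : CircuitWalk hexagon v₁ v₂ w₂
  w₂-walk =
    circuit-step hexagon 1 ⟨ -2 , -1 ⟩ (# 0) ∷ circuit-step hexagon 1 ⟨ -1 , -2 ⟩ (# 3) ∷ [] ,
    λ { zero → refl ; (suc zero) → refl }

  w₃-walk : CircuitWalk hexagon v₁ v₂ w₃
  w₃-walk =
    circuit-step hexagon 2 ⟨ 0 , -1 ⟩ (# 1) ∷ circuit-step hexagon 1 ⟨ -2 , -1 ⟩ (# 0) ∷
    circuit-step hexagon 1 ⟨ -1 , 0 ⟩ (# 2) ∷ [] ,
    λ { zero → refl ; (suc zero) → refl }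

  w₃-maximal : Maximal hexagon v₁ w₃
  w₃-maximal =
      tight-step-maximal hexagon (after 0) 2 ⟨ 0 , -1 ⟩ (# 0) (from-yes (0ℚ ℚ.<? 2)) refl
    , tight-step-maximal hexagon (after 1) 1 ⟨ -2 , -1 ⟩ (# 5) (from-yes (0ℚ ℚ.<? 1)) refl
    , tight-step-maximal hexagon (after 2) 1 ⟨ -1 , 0 ⟩ (# 4) (from-yes (0ℚ ℚ.<? 1)) refl
    , tt
    where
    after : ℕ → Pt
    after i = endpoint hexagon v₁ (take i w₃)

  ⁴⁄₃ : ℚ
  ⁴⁄₃ = 4 / 3

open Hexagon

open Polytope hexagon using (B; d)

hexagon-bounded : Bounded hexagon
hexagon-bounded = ι (ℤ.+ 3) , λ z z∈P k →
  let 0≤zk , zk≤3 = in-square z z∈P k in ℚ.≤-trans (from-yes (- ι (ℤ.+ 3) ℚ.≤? 0ℚ)) 0≤zk , zk≤3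
  where
  in-square : ∀ z → InP hexagon z → ∀ k → 0ℚ ≤ z k × z k ≤ ι (ℤ.+ 3)
  in-square z (_ , z≤d) zero =
    -p≤0⇒0≤p (subst (_≤ 0ℚ) (solve 2 (λ x y → con (ι -1ℤ) :* x :+ con 0ℚ :* y := :- x) refl
                                (z zero) (z (suc zero))) (z≤d (# 4))) ,
    subst (_≤ ι (ℤ.+ 3)) (solve 2 (λ x y → con 1ℚ :* x :+ con 0ℚ :* y := x) refl
                            (z zero) (z (suc zero))) (z≤d (# 1))
  in-square z (_ , z≤d) (suc zero) =
    -p≤0⇒0≤p (subst (_≤ 0ℚ) (solve 2 (λ x y → con 0ℚ :* x :+ con (ι -1ℤ) :* y := :- y) refl
                                (z zero) (z (suc zero))) (z≤d (# 5))) ,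
    subst (_≤ ι (ℤ.+ 3)) (solve 2 (λ x y → con 0ℚ :* x :+ con 1ℚ :* y := y) refl
                            (z zero) (z (suc zero))) (z≤d (# 2))

v₁-vertex : IsVertex hexagon v₁
v₁-vertex = tight-rows⇒vertex hexagon v₁ (# 1) (# 2) (from-yes (InP? hexagon v₁)) refl refl (λ ())

v₂-vertex : IsVertex hexagon v₂
v₂-vertex = tight-rows⇒vertex hexagon v₂ (# 4) (# 5) (from-yes (InP? hexagon v₂)) refl refl (λ ())

edgeNormal : Fin 4 → IntVec
edgeNormal c = B (c ↑ˡ 2)

circuit-⊥-edgeNormal : ∀ {g} → IsCircuit hexagon g → ∃ λ c → row (edgeNormal c) (ιv g) ≡ 0ℚ
circuit-⊥-edgeNormal {g} g-circuit
  with circuit-has-zero-row hexagon {g} {⟨ ι (ℤ.+ 2) , 1ℚ ⟩} (# 0) g-circuit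
         (λ ()) (nonzero-at zero (λ ())) refl
... | zero , Bg≡0                                = # 0 , Bg≡0
... | suc zero , Bg≡0                            = # 1 , Bg≡0
... | suc (suc zero) , Bg≡0                      = # 2 , Bg≡0
... | suc (suc (suc zero)) , Bg≡0                = # 3 , Bg≡0
... | suc (suc (suc (suc zero))) , Bg≡0         =
  # 1 , parallel-row≡0 (B (# 4)) (B (# 1)) {ιv g} refl (nonzero-at zero (λ ())) Bg≡0
... | suc (suc (suc (suc (suc zero)))) , Bg≡0   =
  # 2 , parallel-row≡0 (B (# 5)) (B (# 2)) {ιv g} refl (nonzero-at (suc zero) (λ ())) Bg≡0

levels-differ : ∀ c → row (edgeNormal c) v₁ ≢ row (edgeNormal c) v₂
levels-differ = from-yes (all? λ c → ¬? (row (edgeNormal c) v₁ ℚ.≟ row (edgeNormal c) v₂))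

no-one-step-walk : ∀ s → ¬ CircuitWalk hexagon v₁ v₂ (s ∷ [])
no-one-step-walk (step α g) ((_ , g-circuit) ∷ [] , end) with circuit-⊥-edgeNormal {g} g-circuit
... | c , cg≡0 = levels-differ c
  (trans (sym (row-step-⊥ (edgeNormal c) v₁ α (ιv g) cg≡0)) (row-cong (edgeNormal c) end))

OnLevelLines : Fin 4 → Fin 4 → Pt → Set
OnLevelLines c c′ y =
  row (edgeNormal c) y ≡ row (edgeNormal c) v₁ × row (edgeNormal c′) y ≡ row (edgeNormal c′) v₂

MeetingObstructed : Fin 4 → Fin 4 → Set
MeetingObstructed c c′ =
  det (edgeNormal c) (edgeNormal c′) ≢ 0ℚ × OnLevelLines c c′ (meet c c′) ×
  (¬ InP hexagon (meet c c′) ⊎ InP hexagon (ray v₁ (meet c c′) ⁴⁄₃))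

meetingObstructed? : ∀ c c′ → Dec (MeetingObstructed c c′)
meetingObstructed? c c′ =
        ¬? (det (edgeNormal c) (edgeNormal c′) ℚ.≟ 0ℚ)
  ×-dec (row (edgeNormal c) (meet c c′) ℚ.≟ row (edgeNormal c) v₁
         ×-dec row (edgeNormal c′) (meet c c′) ℚ.≟ row (edgeNormal c′) v₂)
  ×-dec (¬? (InP? hexagon (meet c c′)) ⊎-dec InP? hexagon (ray v₁ (meet c c′) ⁴⁄₃))

meeting-obstructed : ∀ c c′ → c ≢ c′ → MeetingObstructed c c′
meeting-obstructed = from-yes (all? λ c → all? λ c′ → ¬? (c Fin.≟ c′) →-dec meetingObstructed? c c′)

on-level-lines⇒meet : ∀ c c′ y → MeetingObstructed c c′ → OnLevelLines c c′ y → y ≈ meet c c′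
on-level-lines⇒meet c c′ y (det≢0 , (meet-on₁ , meet-on₂) , _) (y-on₁ , y-on₂) =
  rows-determine (edgeNormal c) (edgeNormal c′) det≢0
    (trans y-on₁ (sym meet-on₁)) (trans y-on₂ (sym meet-on₂))

obstructed-turn-not-maximal : ∀ c c′ α g → MeetingObstructed c c′ → 0ℚ < α →
  OnLevelLines c c′ (v₁ ⊕ (α · ιv g)) → InP hexagon (v₁ ⊕ (α · ιv g)) →
  ¬ (∀ β → α < β → ¬ InP hexagon (v₁ ⊕ (β · ιv g)))
obstructed-turn-not-maximal c c′ α g obstructed@(_ , _ , inj₁ meet∉P) _ on-lines y∈P _ =
  meet∉P (InP-resp-≈ hexagon (on-level-lines⇒meet c c′ (v₁ ⊕ (α · ιv g)) obstructed on-lines) y∈P)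
obstructed-turn-not-maximal c c′ α g obstructed@(_ , _ , inj₂ ray∈P) 0<α on-lines _ maximal =
  maximal (α * ⁴⁄₃) (p<p*q 0<α (from-yes (1ℚ ℚ.<? ⁴⁄₃)))
    (InP-resp-≈ hexagon (ray-step v₁ α ⁴⁄₃ (ιv g) y≈meet) ray∈P)
  where
  y≈meet : (v₁ ⊕ (α · ιv g)) ≈ meet c c′
  y≈meet = on-level-lines⇒meet c c′ (v₁ ⊕ (α · ιv g)) obstructed on-lines

turn-not-maximal : ∀ c c′ α g → 0ℚ < α →
  OnLevelLines c c′ (v₁ ⊕ (α · ιv g)) → InP hexagon (v₁ ⊕ (α · ιv g)) →
  ¬ (∀ β → α < β → ¬ InP hexagon (v₁ ⊕ (β · ιv g)))
turn-not-maximal c c′ α g 0<α on-lines@(y-on₁ , y-on₂) y∈P with c Fin.≟ c′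
... | yes refl = λ _ → levels-differ c (trans (sym y-on₁) y-on₂)
... | no c≢c′  = obstructed-turn-not-maximal c c′ α g (meeting-obstructed c c′ c≢c′) 0<α on-lines y∈P

two-step-not-maximal : ∀ s₁ s₂ → CircuitWalk hexagon v₁ v₂ (s₁ ∷ s₂ ∷ []) →
  Feasible hexagon v₁ (s₁ ∷ s₂ ∷ []) → ¬ Maximal hexagon v₁ (s₁ ∷ s₂ ∷ [])
two-step-not-maximal (step α g) (step β h)
  ((0<α , g-circuit) ∷ (_ , h-circuit) ∷ [] , end) (_ , y∈P , _) (maximal , _)
  with circuit-⊥-edgeNormal {g} g-circuit | circuit-⊥-edgeNormal {h} h-circuit
... | c , cg≡0 | c′ , c′h≡0 = turn-not-maximal c c′ α g 0<α (y-on₁ , y-on₂) y∈P maximal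
  where
  y-on₁ : row (edgeNormal c) (v₁ ⊕ (α · ιv g)) ≡ row (edgeNormal c) v₁
  y-on₁ = row-step-⊥ (edgeNormal c) v₁ α (ιv g) cg≡0
  y-on₂ : row (edgeNormal c′) (v₁ ⊕ (α · ιv g)) ≡ row (edgeNormal c′) v₂
  y-on₂ = trans (sym (row-step-⊥ (edgeNormal c′) (v₁ ⊕ (α · ιv g)) β (ιv h) c′h≡0))
                (row-cong (edgeNormal c′) end)

walk-length≥2 : ∀ w → CircuitWalk hexagon v₁ v₂ w → 2 ℕ.≤ length w
walk-length≥2 []          (_ , end) with end zero
... | ()
walk-length≥2 (s ∷ [])    walk = ⊥-elim (no-one-step-walk s walk)
walk-length≥2 (_ ∷ _ ∷ _) _    = ℕ.s≤s (ℕ.s≤s ℕ.z≤n)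

maximal-walk-length≥3 : ∀ w → CircuitWalk hexagon v₁ v₂ w → Feasible hexagon v₁ w →
  Maximal hexagon v₁ w → 3 ℕ.≤ length w
maximal-walk-length≥3 w walk _ _ with walk-length≥2 w walk
maximal-walk-length≥3 (_ ∷ []) _ _ _ | ℕ.s≤s ()
maximal-walk-length≥3 (s₁ ∷ s₂ ∷ []) walk feasible maximal | _ =
  ⊥-elim (two-step-not-maximal s₁ s₂ walk feasible maximal)
maximal-walk-length≥3 (_ ∷ _ ∷ _ ∷ _) _ _ _ | _ = ℕ.s≤s (ℕ.s≤s (ℕ.s≤s ℕ.z≤n))

w₂-feasible : Feasible hexagon v₁ w₂
w₂-feasible = from-yes (Feasible? hexagon v₁ w₂)

w₂-optimal : OptimalFeasible hexagon v₁ v₂ w₂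
w₂-optimal = w₂-walk , w₂-feasible , λ w walk _ → walk-length≥2 w walk

optimal-not-maximal : ∀ w → OptimalFeasible hexagon v₁ v₂ w → ¬ Maximal hexagon v₁ w
optimal-not-maximal w (walk , feasible , optimal) maximal = ℕ.<-irrefl refl
  (ℕ.≤-trans (maximal-walk-length≥3 w walk feasible maximal) (optimal w₂ w₂-walk w₂-feasible))

maximality-gap : ∀ X → HasAll hexagon X v₁ w₃ → HasAll hexagon X v₁ w₂ →
  ∃ λ k₁ → ∃ λ k₂ →
    IsCD hexagon (f ∷ m ∷ X) v₁ v₂ k₁ × IsCD hexagon (f ∷ X) v₁ v₂ k₂ × k₁ ≢ k₂
maximality-gap X X-w₃ X-w₂ = 3 , 2
  , ( (w₃ , w₃-walk , from-yes (Feasible? hexagon v₁ w₃) ∷ w₃-maximal ∷ X-w₃ , refl)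
    , λ { w walk (feasible ∷ maximal ∷ _) → maximal-walk-length≥3 w walk feasible maximal })
  , ((w₂ , w₂-walk , w₂-feasible ∷ X-w₂ , refl) , λ w walk _ → walk-length≥2 w walk)
  , λ ()

lemma5 : Σ Polytope λ P → Σ Pt λ v₁ → Σ Pt λ v₂ →
    Bounded P × IsVertex P v₁ × IsVertex P v₂
    × (∀ w → OptimalFeasible P v₁ v₂ w → ¬ Maximal P v₁ w)
    × (∃ λ w → OptimalFeasible P v₁ v₂ w × NonRepetitive P w × NonBackwards P w)
    × (∃ λ k₁ → ∃ λ k₂ → IsCD P (f ∷ m ∷ []) v₁ v₂ k₁ × IsCD P (f ∷ []) v₁ v₂ k₂ × k₁ ≢ k₂)
    × (∃ λ k₁ → ∃ λ k₂ → IsCD P (f ∷ m ∷ b ∷ []) v₁ v₂ k₁ × IsCD P (f ∷ b ∷ []) v₁ v₂ k₂ × k₁ ≢ k₂)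
    × (∃ λ k₁ → ∃ λ k₂ → IsCD P (f ∷ m ∷ r ∷ []) v₁ v₂ k₁ × IsCD P (f ∷ r ∷ []) v₁ v₂ k₂ × k₁ ≢ k₂)
lemma5 = hexagon , v₁ , v₂ , hexagon-bounded , v₁-vertex , v₂-vertex , optimal-not-maximal
  , (w₂ , w₂-optimal , w₂-nonRepetitive , w₂-nonBackwards)
  , maximality-gap [] [] []
  , maximality-gap (b ∷ []) (from-yes (NonBackwards? hexagon w₃) ∷ []) (w₂-nonBackwards ∷ [])
  , maximality-gap (r ∷ []) (from-yes (NonRepetitive? hexagon w₃) ∷ []) (w₂-nonRepetitive ∷ [])
  where
  w₂-nonRepetitive : NonRepetitive hexagon w₂
  w₂-nonRepetitive = from-yes (NonRepetitive? hexagon w₂)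
  w₂-nonBackwards : NonBackwards hexagon w₂
  w₂-nonBackwards = from-yes (NonBackwards? hexagon w₂)
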